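{- $\mathrm{CSP}(\mathbb{Q};\mathrm{R}^{\le}_{\min},<)$ is expressible in FP, where $\mathrm{R}^{\le}_{\min}=\{(x,y,z)\in\mathbb{Q}^3: y\le x \text{ or } z\le x\}$.
   Context: For a structure $\mathfrak{B}$ with finite relational signature $\tau$, $\mathrm{CSP}(\mathfrak{B})$ is the class of finite $\tau$-structures admitting a homomorphism to $\mathfrak{B}$; it is expressible in FP (fixed-point logic) if some FP sentence over $\tau$ holds exactly in those finite $\tau$-structures that admit no homomorphism to $\mathfrak{B}$. -}

module Defs where

open import Data.Nat using (ℕ; zero; suc; _+_; _^_)
open import Data.Fin using (Fin)
open import Data.Bool using (Bool; true; false; _∧_; _∨_; not)
open import Data.Vec using (Vec; lookup; map; _++_)
open import Data.List using (List; []; _∷_; allFin)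
open import Data.Bool.ListAction using (any)
open import Data.Product using (_×_; _,_; ∃-syntax; Σ-syntax)
open import Data.Sum using (_⊎_)
open import Data.Unit using (⊤; tt)
open import Data.Rational using (ℚ; _≤_; _<_)
open import Relation.Binary.PropositionalEquality using (_≡_)
open import Relation.Nullary using (¬_)
open import Function using (_⇔_)

record τStructure : Set where
  field
    size : ℕ
    Rrel : Fin size → Fin size → Fin size → Bool
    Lrel : Fin size → Fin size → Bool
open τStructure public

R≤min : ℚ → ℚ → ℚ → Set
R≤min x y z = (y ≤ x) ⊎ (z ≤ x)

IsHom : (A : τStructure) → (Fin (size A) → ℚ) → Set
IsHom A h =
  (∀ a b c → Rrel A a b c ≡ true → R≤min (h a) (h b) (h c)) ×
  (∀ a b → Lrel A a b ≡ true → h a < h b)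

InCSP : τStructure → Set
InCSP A = ∃[ h ] IsHom A h

-- Fixed-point logic FP over τ (inflationary fixed points, IFP).
-- Formula Γ m : Γ lists the arities of free second-order (fixed-point)
-- variables, m is the number of free first-order variables.

data RVar : List ℕ → ℕ → Set where
  here  : ∀ {Γ k} → RVar (k ∷ Γ) k
  there : ∀ {Γ k j} → RVar Γ k → RVar (j ∷ Γ) k

data Formula (Γ : List ℕ) (m : ℕ) : Set where
  atomR  : Fin m → Fin m → Fin m → Formula Γ m
  atomL  : Fin m → Fin m → Formula Γ m
  atomEq : Fin m → Fin m → Formula Γ m
  atomX  : ∀ {k} → RVar Γ k → Vec (Fin m) k → Formula Γ m
  neg    : Formula Γ m → Formula Γ m
  conj   : Formula Γ m → Formula Γ m → Formula Γ m
  disj   : Formula Γ m → Formula Γ m → Formula Γ m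
  ex     : Formula Γ (suc m) → Formula Γ m
  all    : Formula Γ (suc m) → Formula Γ m
  -- [ifp_{X, x₁…x_k} φ](t₁,…,t_k): φ has the k fixed-point variables
  -- x₁…x_k first, followed by the m parameters; X is the new
  -- second-order variable of arity k.
  ifp    : ∀ {k} → Formula (k ∷ Γ) (k + m) → Vec (Fin m) k → Formula Γ m

Sentence : Set
Sentence = Formula [] 0

RelOn : ℕ → ℕ → Set
RelOn n k = Vec (Fin n) k → Bool

RelEnv : ℕ → List ℕ → Set
RelEnv n [] = ⊤
RelEnv n (k ∷ Γ) = RelOn n k × RelEnv n Γ

lookupR : ∀ {n Γ k} → RelEnv n Γ → RVar Γ k → RelOn n k
lookupR (X , _) here = X
lookupR (_ , σ) (there v) = lookupR σ v

iter : ∀ {A : Set} → ℕ → (A → A) → A → A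
iter zero f a = a
iter (suc i) f a = f (iter i f a)

eqFin : ∀ {n} → Fin n → Fin n → Bool
eqFin Fin.zero Fin.zero = true
eqFin Fin.zero (Fin.suc _) = false
eqFin (Fin.suc _) Fin.zero = false
eqFin (Fin.suc a) (Fin.suc b) = eqFin a b

anyFin : ∀ n → (Fin n → Bool) → Bool
anyFin n p = any p (allFin n)

allFin? : ∀ n → (Fin n → Bool) → Bool
allFin? n p = not (any (λ a → not (p a)) (allFin n))

eval : ∀ {Γ m} (A : τStructure) → Formula Γ m →
       RelEnv (size A) Γ → Vec (Fin (size A)) m → Bool
eval A (atomR x y z) σ ρ = Rrel A (lookup ρ x) (lookup ρ y) (lookup ρ z)
eval A (atomL x y) σ ρ = Lrel A (lookup ρ x) (lookup ρ y)
eval A (atomEq x y) σ ρ = eqFin (lookup ρ x) (lookup ρ y)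
eval A (atomX v ts) σ ρ = lookupR σ v (map (lookup ρ) ts)
eval A (neg φ) σ ρ = not (eval A φ σ ρ)
eval A (conj φ ψ) σ ρ = eval A φ σ ρ ∧ eval A ψ σ ρ
eval A (disj φ ψ) σ ρ = eval A φ σ ρ ∨ eval A ψ σ ρ
eval A (ex φ) σ ρ = anyFin (size A) (λ a → eval A φ σ (a Data.Vec.∷ ρ))
eval A (all φ) σ ρ = allFin? (size A) (λ a → eval A φ σ (a Data.Vec.∷ ρ))
eval A (ifp {k} φ ts) σ ρ =
  iter (size A ^ k) step (λ _ → false) (map (lookup ρ) ts)
  where
  -- inflationary stage: X_{i+1} = X_i ∪ φ(X_i); the sequence stabilises
  -- after at most |A|^k steps, so stage |A|^k is the inflationary fixed point.
  step : RelOn (size A) k → RelOn (size A) k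
  step X xs = X xs ∨ eval A φ (X , σ) (xs ++ ρ)

_⊨_ : τStructure → Sentence → Set
A ⊨ φ = eval A φ tt Data.Vec.[] ≡ true

CSPinFP : (τStructure → Set) → Set
CSPinFP Csp = Σ[ φ ∈ Sentence ] (∀ (A : τStructure) → (A ⊨ φ) ⇔ (¬ Csp A))

-- A finite structure A maps to (ℚ; R^≤_min, <) iff its elements can
-- be sorted into layers 0, 1, 2, … such that L-edges go strictly upwards
-- and every R(x, y, z) has y or z in a layer ≤ that of x.  Given the union
-- T of the layers built so far, an element outside T is *forced* (cannot
-- sit in the next layer) if it has an L-predecessor outside T, or an
-- R-tuple R(u, y, z) with y and z both forced; the forced set is an
-- inductive fixed point.  The next layer consists of all unforced
-- elements outside T, so the layers are an inflationary fixed point too.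

module Submission where

open import Defs
open import Data.Nat as ℕ using (ℕ; zero; suc; _^_; z≤n; s≤s)
import Data.Nat.Properties as ℕP
open import Data.Integer as ℤ using (+_)
import Data.Integer.Properties as ℤP
open import Data.Rational as ℚ using (ℚ; mkℚ; *≤*; *<*)
import Data.Rational.Properties as ℚP
open import Data.Nat.Coprimality using (1-coprimeTo) renaming (sym to coprime-sym)
open import Data.Fin using (Fin)
open import Data.Bool using (Bool; true; false; _∧_; _∨_; not; _≟_)
open import Data.Bool.Properties using (T-≡; ∨-zeroʳ; ¬-not)
open import Data.Bool.ListAction using (any)
open import Data.Vec using (Vec; []; _∷_; _++_)
open import Data.List as List using (List; allFin; length; filter)
import Data.List.Properties as ListP
open import Data.List.Membership.Propositional using (_∈_; lose)
open import Data.List.Membership.Propositional.Properties using (∈-allFin; ∈-map⁺; ∈-filter⁺)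
open import Data.List.Relation.Unary.Any using (here; there; satisfied)
open import Data.List.Relation.Unary.Any.Properties using (any⁺; any⁻)
import Data.List.Relation.Unary.All as All
open import Data.List.Relation.Unary.All.Properties using (all-filter)
import Data.List.Extrema
open import Data.Product using (Σ; _×_; _,_; ∃; proj₁; proj₂)
open import Data.Sum using (_⊎_; inj₁; inj₂)
import Data.Sum as Sum
open import Data.Unit using (tt)
open import Data.Empty using (⊥-elim)
open import Function using (mk⇔; Equivalence)
open import Relation.Binary.Bundles using (DecTotalOrder)
open import Relation.Binary.PropositionalEquality
open import Relation.Nullary using (Dec; contradiction)

∨-true : ∀ {a b} → a ∨ b ≡ true → a ≡ true ⊎ b ≡ true
∨-true {true} _ = inj₁ refl
∨-true {false} e = inj₂ e

∨-false : ∀ {a b} → a ∨ b ≡ false → a ≡ false × b ≡ false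
∨-false {false} e = refl , e

∨-elimˡ : ∀ {a b} → a ≡ false → a ∨ b ≡ true → b ≡ true
∨-elimˡ refl e = e

∧-true : ∀ {a b} → a ∧ b ≡ true → a ≡ true × b ≡ true
∧-true {true} e = refl , e

∧-false : ∀ {a b} → a ∧ b ≡ false → a ≡ false ⊎ b ≡ false
∧-false {false} _ = inj₁ refl
∧-false {true} e = inj₂ e

∧-elimˡ : ∀ {a b} → a ≡ true → a ∧ b ≡ false → b ≡ false
∧-elimˡ refl e = e

∧-elimʳ : ∀ {a b} → b ≡ true → a ∧ b ≡ false → a ≡ false
∧-elimʳ {false} _ _ = refl
∧-elimʳ {true} refl ()

not-true : ∀ {a} → not a ≡ true → a ≡ false
not-true {false} _ = refl

not-false : ∀ {a} → not a ≡ false → a ≡ true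
not-false {true} _ = refl

module _ {E : Set} (p : E → Bool) where

  any-true : ∀ xs → any p xs ≡ true → ∃ λ x → p x ≡ true
  any-true xs e with satisfied (any⁻ p xs (Equivalence.from T-≡ e))
  ... | x , px = x , Equivalence.to T-≡ px

  any-false : ∀ {xs} → any p xs ≡ false → ∀ {x} → x ∈ xs → p x ≡ false
  any-false e x∈xs = ¬-not λ px →
    contradiction (trans (sym (Equivalence.to T-≡ (any⁺ p (lose x∈xs (Equivalence.from T-≡ px))))) e) λ ()

anyFin-true : ∀ {n} {p : Fin n → Bool} → anyFin n p ≡ true → ∃ λ i → p i ≡ true
anyFin-true {n} {p} = any-true p (allFin n)

anyFin-false : ∀ {n} {p : Fin n → Bool} → anyFin n p ≡ false → ∀ i → p i ≡ false
anyFin-false {p = p} e i = any-false p e (∈-allFin i)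

anyFin-cong : ∀ {n} {p q : Fin n → Bool} → p ≗ q → anyFin n p ≡ anyFin n q
anyFin-cong {n} p≗q = cong (List.foldr _∨_ false) (ListP.map-cong p≗q (allFin n))

leastWitness : (p : ℕ → Bool) (k : ℕ) → p k ≡ true →
               Σ ℕ λ m → p m ≡ true × (∀ {j} → p j ≡ true → m ℕ.≤ j)
leastWitness p zero pk = zero , pk , λ _ → z≤n
leastWitness p (suc k) pk with p zero in p0
... | true = zero , p0 , λ _ → z≤n
... | false with leastWitness (λ i → p (suc i)) k pk
...   | m , pm , least = suc m , pm , minimal
  where
  minimal : ∀ {j} → p j ≡ true → suc m ℕ.≤ j
  minimal {zero} pj = contradiction (trans (sym p0) pj) λ ()
  minimal {suc j} pj = s≤s (least pj)

fromℕ : ℕ → ℚ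
fromℕ k = mkℚ (+ k) 0 (coprime-sym (1-coprimeTo k))

fromℕ-mono-≤ : ∀ {i j} → i ℕ.≤ j → fromℕ i ℚ.≤ fromℕ j
fromℕ-mono-≤ {i} {j} i≤j =
  *≤* (subst₂ ℤ._≤_ (sym (ℤP.*-identityʳ (+ i))) (sym (ℤP.*-identityʳ (+ j))) (ℤ.+≤+ i≤j))

fromℕ-mono-< : ∀ {i j} → i ℕ.< j → fromℕ i ℚ.< fromℕ j
fromℕ-mono-< {i} {j} i<j =
  *<* (subst₂ ℤ._<_ (sym (ℤP.*-identityʳ (+ i))) (sym (ℤP.*-identityʳ (+ j))) (ℤ.+<+ i<j))

minimiser : ∀ {n} (h : Fin n → ℚ) (p : Fin n → Bool) (a : Fin n) → p a ≡ false →
            ∃ λ b₀ → p b₀ ≡ false × (∀ b → p b ≡ false → h b₀ ℚ.≤ h b)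
minimiser {n} h p a pa = b₀ , b₀-outside , b₀-minimal
  where
  open Data.List.Extrema (DecTotalOrder.totalOrder ℚP.≤-decTotalOrder)
  outside : ∀ b → Dec (p b ≡ false)
  outside b = p b ≟ false
  candidates : List (Fin n)
  candidates = filter outside (allFin n)
  b₀ : Fin n
  b₀ = argmin h a candidates
  b₀-outside : p b₀ ≡ false
  b₀-outside = argmin-all h pa (all-filter outside (allFin n))
  b₀-minimal : ∀ b → p b ≡ false → h b₀ ℚ.≤ h b
  b₀-minimal b pb = All.lookup (f[argmin]≤f[xs] a candidates) (∈-filter⁺ outside (∈-allFin b) pb)

iter-cong : ∀ {E : Set} {s s′ : (E → Bool) → E → Bool} →
            (∀ {X Y} → X ≗ Y → s X ≗ s′ Y) →
            ∀ i → iter i s (λ _ → false) ≗ iter i s′ (λ _ → false)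
iter-cong s≈s′ zero e = refl
iter-cong s≈s′ (suc i) = s≈s′ (iter-cong s≈s′ i)

-- Inflationary fixed points over a finite set E, listed by `elems`: the
-- stages grow strictly until they stabilise, and a subset of E has at
-- most length elems elements, so stage N is a fixed point once
-- N ≥ length elems.

module InflationaryFixedPoint {E : Set} (elems : List E) (complete : ∀ e → e ∈ elems)
  (step : (E → Bool) → E → Bool)
  (step-cong : ∀ {X Y} → X ≗ Y → step X ≗ step Y)
  (inflationary : ∀ X {e} → X e ≡ true → step X e ≡ true) where

  stage : ℕ → E → Bool
  stage i = iter i step (λ _ → false)

  indicator : Bool → ℕ
  indicator true = 1
  indicator false = 0

  count : (E → Bool) → List E → ℕ
  count X List.[] = 0
  count X (e List.∷ es) = indicator (X e) ℕ.+ count X es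

  _⊆_ : (E → Bool) → (E → Bool) → Set
  X ⊆ Y = ∀ {e} → X e ≡ true → Y e ≡ true

  indicator-mono : ∀ {a b} → (a ≡ true → b ≡ true) → indicator a ℕ.≤ indicator b
  indicator-mono {false} _ = z≤n
  indicator-mono {true} a⇒b rewrite a⇒b refl = ℕP.≤-refl

  count-mono : ∀ {X Y} → X ⊆ Y → ∀ es → count X es ℕ.≤ count Y es
  count-mono X⊆Y List.[] = z≤n
  count-mono X⊆Y (e List.∷ es) = ℕP.+-mono-≤ (indicator-mono X⊆Y) (count-mono X⊆Y es)

  count-strict : ∀ {X Y e} → X ⊆ Y → X e ≡ false → Y e ≡ true →
                 ∀ {es} → e ∈ es → count X es ℕ.< count Y es
  count-strict {X} {Y} X⊆Y Xe Ye {e List.∷ es} (here refl)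
    rewrite Xe | Ye = s≤s (count-mono X⊆Y es)
  count-strict X⊆Y Xe Ye {d List.∷ es} (there e∈es) =
    ℕP.+-mono-≤-< (indicator-mono X⊆Y) (count-strict X⊆Y Xe Ye e∈es)

  count-bound : ∀ X es → count X es ℕ.≤ length es
  count-bound X List.[] = z≤n
  count-bound X (e List.∷ es) = ℕP.+-mono-≤ (indicator-mono {b = true} λ _ → refl) (count-bound X es)

  step-grows : ∀ X → step X ≗ X ⊎ count X elems ℕ.< count (step X) elems
  step-grows X with any (λ e → not (X e) ∧ step X e) elems in new
  ... | true with any-true _ elems new
  ...   | e , fresh with ∧-true fresh
  ...     | e∉X , e∈step =
    inj₂ (count-strict (inflationary X) (not-true e∉X) e∈step (complete e))
  step-grows X | false = inj₁ unchanged
    where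
    unchanged : step X ≗ X
    unchanged e with X e in Xe
    ... | true = inflationary X Xe
    ... | false = ∧-elimˡ (cong not Xe) (any-false _ new (complete e))

  growth : ∀ i → step (stage i) ≗ stage i ⊎ i ℕ.≤ count (stage i) elems
  growth zero = inj₂ z≤n
  growth (suc i) with growth i
  ... | inj₁ fixed = inj₁ (step-cong fixed)
  ... | inj₂ big with step-grows (stage i)
  ...   | inj₁ fixed = inj₁ (step-cong fixed)
  ...   | inj₂ bigger = inj₂ (ℕP.≤-<-trans big bigger)

  stable : ∀ N → length elems ℕ.≤ N → step (stage N) ≗ stage N
  stable N enough with growth N
  ... | inj₁ fixed = fixed
  ... | inj₂ big with step-grows (stage N)
  ...   | inj₁ fixed = fixed
  ...   | inj₂ bigger = ⊥-elim (ℕP.<-irrefl refl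
          (ℕP.≤-<-trans big (ℕP.<-≤-trans bigger
            (ℕP.≤-trans (count-bound (step (stage N)) elems) enough))))

module _ {n : ℕ} where

  singletons : List (Vec (Fin n) 1)
  singletons = List.map (_∷ []) (allFin n)

  singletons-complete : ∀ v → v ∈ singletons
  singletons-complete (u ∷ []) = ∈-map⁺ (_∷ []) (∈-allFin u)

  length-singletons : length singletons ℕ.≤ n ^ 1
  length-singletons = ℕP.≤-reflexive (begin
    length singletons ≡⟨ ListP.length-map (_∷ []) (allFin n) ⟩
    length (allFin n) ≡⟨ ListP.length-tabulate (λ i → i) ⟩
    n                 ≡⟨ sym (ℕP.^-identityʳ n) ⟩
    n ^ 1             ∎)
    where open ≡-Reasoning

  unary-stable : (step : RelOn n 1 → RelOn n 1) →
                 (∀ {X Y} → X ≗ Y → step X ≗ step Y) →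
                 (∀ X {v} → X v ≡ true → step X v ≡ true) →
                 let X∞ = iter (n ^ 1) step (λ _ → false) in step X∞ ≗ X∞
  unary-stable step step-cong inflationary =
    InflationaryFixedPoint.stable singletons singletons-complete step step-cong inflationary
      (n ^ 1) length-singletons

-- The FP sentence.  Relation variables: `here` is the innermost one.
--
-- forcedFormula(y; N, T): y ∉ T, and either L(b, y) for some b ∉ T, or
-- R(y, y′, z′) for some y′, z′ ∈ N.  (The last two first-order variables
-- are parameters of the enclosing formula; they do not occur.)

forcedFormula : Formula (1 List.∷ 1 List.∷ List.[]) 3
forcedFormula =
  conj (neg (atomX (RVar.there RVar.here) (Fin.zero ∷ [])))
       (disj (ex (conj (neg (atomX (RVar.there RVar.here) (Fin.zero ∷ [])))
                       (atomL Fin.zero (Fin.suc Fin.zero))))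
             (ex (ex (conj (atomR (Fin.suc (Fin.suc Fin.zero)) (Fin.suc Fin.zero) Fin.zero)
                           (conj (atomX RVar.here (Fin.suc Fin.zero ∷ []))
                                 (atomX RVar.here (Fin.zero ∷ [])))))))

-- layerFormula(x; T): x is not forced relative to T, i.e. x may be
-- placed in the layer directly above T.
layerFormula : Formula (1 List.∷ List.[]) 2
layerFormula = neg (ifp forcedFormula (Fin.zero ∷ []))

-- Some element is never placed in a layer.
sentence : Sentence
sentence = ex (neg (ifp layerFormula (Fin.zero ∷ [])))

module Layers (A : τStructure) where

  n : ℕ
  n = size A

  Unary : Set
  Unary = RelOn n 1

  _⟨_⟩ : Unary → Fin n → Bool
  X ⟨ u ⟩ = X (u ∷ [])

  ∅ : Unary
  ∅ _ = false

  lowerOutside : Unary → Fin n → Bool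
  lowerOutside T u = anyFin n λ b → not (T ⟨ b ⟩) ∧ Lrel A b u

  supported : Unary → Fin n → Bool
  supported N u = anyFin n λ y → anyFin n λ z → Rrel A u y z ∧ (N ⟨ y ⟩ ∧ N ⟨ z ⟩)

  forcedStep : Unary → Unary → Unary
  forcedStep T N (u ∷ []) = N ⟨ u ⟩ ∨ (not (T ⟨ u ⟩) ∧ (lowerOutside T u ∨ supported N u))

  forced : Unary → Unary
  forced T = iter (n ^ 1) (forcedStep T) ∅

  layerStep : Unary → Unary
  layerStep T (x ∷ []) = T ⟨ x ⟩ ∨ not (forced T ⟨ x ⟩)

  layer : ℕ → Unary
  layer i = iter i layerStep ∅

  forcedStep-cong : ∀ {T T′ N N′} → T ≗ T′ → N ≗ N′ → forcedStep T N ≗ forcedStep T′ N′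
  forcedStep-cong T≗T′ N≗N′ (u ∷ []) =
    cong₂ _∨_ (N≗N′ _) (cong₂ _∧_ (cong not (T≗T′ _)) (cong₂ _∨_
      (anyFin-cong λ b → cong (λ t → not t ∧ Lrel A b u) (T≗T′ _))
      (anyFin-cong λ y → anyFin-cong λ z →
        cong₂ (λ s t → Rrel A u y z ∧ (s ∧ t)) (N≗N′ _) (N≗N′ _))))

  forced-cong : ∀ {T T′} → T ≗ T′ → forced T ≗ forced T′
  forced-cong T≗T′ = iter-cong (forcedStep-cong T≗T′) (n ^ 1)

  layerStep-cong : ∀ {T T′} → T ≗ T′ → layerStep T ≗ layerStep T′
  layerStep-cong T≗T′ (x ∷ []) = cong₂ _∨_ (T≗T′ _) (cong not (forced-cong T≗T′ _))

  forced-stable : ∀ T → forcedStep T (forced T) ≗ forced T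
  forced-stable T = unary-stable (forcedStep T) (forcedStep-cong (λ _ → refl)) grows
    where
    grows : ∀ N {v} → N v ≡ true → forcedStep T N v ≡ true
    grows N {u ∷ []} Nu rewrite Nu = refl

  layer-stable : layerStep (layer (n ^ 1)) ≗ layer (n ^ 1)
  layer-stable = unary-stable layerStep layerStep-cong grows
    where
    grows : ∀ T {v} → T v ≡ true → layerStep T v ≡ true
    grows T {x ∷ []} Tx rewrite Tx = refl

  -- Evaluating the sentence computes exactly these layers; the parameters
  -- x and a of the inner fixed point are irrelevant.

  innerStep-agrees : ∀ (ρ : Vec (Fin n) 2) {T T′ N N′} → T ≗ T′ → N ≗ N′ →
                     (λ ys → N ys ∨ eval A forcedFormula (N , T , tt) (ys ++ ρ))
                       ≗ forcedStep T′ N′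
  innerStep-agrees ρ T≗T′ N≗N′ (u ∷ []) = forcedStep-cong T≗T′ N≗N′ (u ∷ [])

  outerStep-agrees : ∀ a {T T′} → T ≗ T′ →
                     (λ xs → T xs ∨ eval A layerFormula (T , tt) (xs ++ a ∷ []))
                       ≗ layerStep T′
  outerStep-agrees a T≗T′ (x ∷ []) =
    cong₂ _∨_ (T≗T′ _) (cong not (iter-cong (innerStep-agrees (x ∷ a ∷ []) T≗T′) (n ^ 1) _))

  sentence-meaning : eval A sentence tt [] ≡ anyFin n (λ a → not (layer (n ^ 1) ⟨ a ⟩))
  sentence-meaning = anyFin-cong λ a → cong not (iter-cong (outerStep-agrees a) (n ^ 1) _)

  forced-above : ∀ {h b₀} T → IsHom A h → (∀ b → T ⟨ b ⟩ ≡ false → h b₀ ℚ.≤ h b) →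
                 ∀ i u → iter i (forcedStep T) ∅ ⟨ u ⟩ ≡ true → h b₀ ℚ.< h u
  forced-above T hom b₀-min zero u ()
  forced-above T hom b₀-min (suc i) u u∈N with ∨-true u∈N
  ... | inj₁ earlier = forced-above T hom b₀-min i u earlier
  ... | inj₂ new with ∨-true (proj₂ (∧-true new))
  ...   | inj₁ lower with anyFin-true lower
  ...     | b , q with ∧-true q
  ...       | b∉T , Lbu = ℚP.≤-<-trans (b₀-min b (not-true b∉T)) (proj₂ hom b u Lbu)
  forced-above T hom b₀-min (suc i) u u∈N | inj₂ new | inj₂ support with anyFin-true support
  ...     | y , q with anyFin-true q
  ...       | z , q′ with ∧-true q′
  ...         | Ruyz , yz∈N with ∧-true yz∈N | proj₁ hom u y z Ruyz
  ...           | y∈N , _ | inj₁ y≤u = ℚP.<-≤-trans (forced-above T hom b₀-min i y y∈N) y≤u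
  ...           | _ , z∈N | inj₂ z≤u = ℚP.<-≤-trans (forced-above T hom b₀-min i z z∈N) z≤u

  -- If A has a homomorphism, the only T with layerStep T = T is everything:
  -- an h-minimal b₀ outside T is unforced, so it would enter the next layer.
  hom⇒stable-full : ∀ {h T} → IsHom A h → layerStep T ≗ T → ∀ a → T ⟨ a ⟩ ≡ true
  hom⇒stable-full {h} {T} hom fixed a with T ⟨ a ⟩ in a∉T
  ... | true = refl
  ... | false with minimiser h (T ⟨_⟩) a a∉T
  ...   | b₀ , b₀∉T , b₀-min = ⊥-elim (ℚP.<-irrefl refl (forced-above T hom b₀-min (n ^ 1) b₀ b₀-forced))
    where
    b₀-forced : forced T ⟨ b₀ ⟩ ≡ true
    b₀-forced = not-false (proj₂ (∨-false (trans (fixed (b₀ ∷ [])) b₀∉T)))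

  unforced : ∀ {T x} → T ⟨ x ⟩ ≡ false → forced T ⟨ x ⟩ ≡ false →
             lowerOutside T x ≡ false × supported (forced T) x ≡ false
  unforced {T} {x} x∉T x-unforced =
    ∨-false (∧-elimˡ (cong not x∉T) (proj₂ (∨-false (trans (forced-stable T (x ∷ [])) x-unforced))))

  enters-next : ∀ {i w} → forced (layer i) ⟨ w ⟩ ≡ false → layer (suc i) ⟨ w ⟩ ≡ true
  enters-next {i} {w} w-unforced =
    subst (λ f → layer i ⟨ w ⟩ ∨ not f ≡ true) (sym w-unforced) (∨-zeroʳ _)

  module Ranking (exhausted : ∀ a → layer (n ^ 1) ⟨ a ⟩ ≡ true) where

    rankWitness : ∀ x → Σ ℕ λ m → layer m ⟨ x ⟩ ≡ true × (∀ {j} → layer j ⟨ x ⟩ ≡ true → m ℕ.≤ j)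
    rankWitness x = leastWitness (λ i → layer i ⟨ x ⟩) (n ^ 1) (exhausted x)

    rank : Fin n → ℕ
    rank x = proj₁ (rankWitness x)

    rank-least : ∀ {x j} → layer j ⟨ x ⟩ ≡ true → rank x ℕ.≤ j
    rank-least {x} = proj₂ (proj₂ (rankWitness x))

    rank-entry : ∀ x → ∃ λ i → rank x ≡ suc i × layer i ⟨ x ⟩ ≡ false × forced (layer i) ⟨ x ⟩ ≡ false
    rank-entry x with rank x | proj₁ (proj₂ (rankWitness x)) | rank-least {x}
    ... | suc i | entered | least = i , refl , x∉layer , not-true (∨-elimˡ x∉layer entered)
      where
      x∉layer : layer i ⟨ x ⟩ ≡ false
      x∉layer = ¬-not λ x∈layer → ℕP.n≮n i (least x∈layer)

    rank-L : ∀ a b → Lrel A a b ≡ true → rank a ℕ.< rank b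
    rank-L a b Lab with rank-entry b
    ... | i , rank≡ , b∉layer , b-unforced =
      subst (rank a ℕ.<_) (sym rank≡) (s≤s (rank-least a∈layer))
      where
      a∈layer : layer i ⟨ a ⟩ ≡ true
      a∈layer = not-false (∧-elimʳ Lab (anyFin-false (proj₁ (unforced b∉layer b-unforced)) a))

    rank-R : ∀ x y z → Rrel A x y z ≡ true → rank y ℕ.≤ rank x ⊎ rank z ℕ.≤ rank x
    rank-R x y z Rxyz with rank-entry x
    ... | i , rank≡ , x∉layer , x-unforced =
      Sum.map below below (∧-false (∧-elimˡ Rxyz
        (anyFin-false (anyFin-false (proj₂ (unforced x∉layer x-unforced)) y) z)))
      where
      below : ∀ {w} → forced (layer i) ⟨ w ⟩ ≡ false → rank w ℕ.≤ rank x
      below w-unforced = subst (_ ℕ.≤_) (sym rank≡) (rank-least (enters-next {i} w-unforced))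

    height : Fin n → ℚ
    height x = fromℕ (rank x)

    height-hom : IsHom A height
    height-hom = (λ x y z Rxyz → Sum.map fromℕ-mono-≤ fromℕ-mono-≤ (rank-R x y z Rxyz))
               , (λ a b Lab → fromℕ-mono-< (rank-L a b Lab))

  sentence⇒gap : A ⊨ sentence → ∃ λ a → layer (n ^ 1) ⟨ a ⟩ ≡ false
  sentence⇒gap holds with anyFin-true (trans (sym sentence-meaning) holds)
  ... | a , gap = a , not-true gap

  sentence-false⇒exhausted : eval A sentence tt [] ≡ false → ∀ a → layer (n ^ 1) ⟨ a ⟩ ≡ true
  sentence-false⇒exhausted fails a =
    not-false (anyFin-false (trans (sym sentence-meaning) fails) a)

proposition3p6 : CSPinFP InCSP
proposition3p6 = sentence , λ A → let open Layers A in mk⇔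
  -- a gap in the layers rules out a homomorphism, since homomorphisms
  -- force the stable layer set to be everything
  (λ holds (h , hom) → let (a , gap) = sentence⇒gap holds in
    contradiction (trans (sym (hom⇒stable-full hom layer-stable a)) gap) λ ())
  -- otherwise the layers exhaust A and the layer index is a homomorphism
  (λ noHom → ¬-not λ fails → noHom (_ , Ranking.height-hom (sentence-false⇒exhausted fails)))
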